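{- Let $a, b$ be positive integers and let $p \ge 11$ be a prime. If $\Phi_p(x) \mid Q_{a,b}(x)$ or $\Phi_p(x) \mid R_{a,b}(x)$, then $p \mid a$ and $p \mid b$.
   Context: $\Phi_p(x)$ denotes the $p$-th cyclotomic polynomial, $\Phi_p(x) = 1 + x + \dots + x^{p-1}$ for prime $p$. For positive integers $a,b$: $Q_{a,b}(x) = x^{2a+b} + x^{a+2b} + x^a + x^b - x^{2a+2b} - x^{2a} - x^{2b} - 1$ and $R_{a,b}(x) = x^{2a+b} + x^{a+2b} + x^a + x^b + x^{2a+2b} + x^{2a} + x^{2b} + 1$. -}

module Defs where

open import Data.Nat as ℕ using (ℕ; zero; suc)
open import Data.Integer as ℤ using (ℤ; +_; 0ℤ; 1ℤ)
open import Data.List using (List; []; _∷_; replicate; map)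
open import Data.Product using (∃)
open import Relation.Binary.PropositionalEquality using (_≡_)

-- Polynomials with integer coefficients, as coefficient lists
-- (lowest degree first).  Two lists represent the same polynomial
-- iff all their coefficients agree (trailing zeros are irrelevant).
Poly : Set
Poly = List ℤ

coeff : Poly → ℕ → ℤ
coeff []       _       = 0ℤ
coeff (c ∷ _)  zero    = c
coeff (_ ∷ cs) (suc n) = coeff cs n

infixr 6 _⊕_
infix 8 ⊖_
infixr 7 _⊗_
infix 4 _≈P_ _∣P_

_⊕_ : Poly → Poly → Poly
[]       ⊕ q        = q
p        ⊕ []       = p
(a ∷ p)  ⊕ (b ∷ q)  = (a ℤ.+ b) ∷ (p ⊕ q)

_·_ : ℤ → Poly → Poly
c · p = map (c ℤ.*_) p

_⊗_ : Poly → Poly → Poly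
[]      ⊗ q = []
(a ∷ p) ⊗ q = (a · q) ⊕ (0ℤ ∷ (p ⊗ q))

⊖_ : Poly → Poly
⊖ p = map ℤ.-_ p

X^ : ℕ → Poly
X^ n = replicate n 0ℤ Data.List.++ (1ℤ ∷ [])
  where import Data.List

_≈P_ : Poly → Poly → Set
p ≈P q = ∀ n → coeff p n ≡ coeff q n

_∣P_ : Poly → Poly → Set
f ∣P g = ∃ λ (h : Poly) → (f ⊗ h) ≈P g

-- Φ_p(x) = 1 + x + ... + x^(p-1)  (the p-th cyclotomic polynomial, p prime)
Φ : ℕ → Poly
Φ p = replicate p 1ℤ

Q : ℕ → ℕ → Poly
Q a b = X^ (2 ℕ.* a ℕ.+ b) ⊕ (X^ (a ℕ.+ 2 ℕ.* b) ⊕ (X^ a ⊕ (X^ b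
      ⊕ (⊖ (X^ (2 ℕ.* a ℕ.+ 2 ℕ.* b)) ⊕ (⊖ (X^ (2 ℕ.* a)) ⊕ (⊖ (X^ (2 ℕ.* b)) ⊕ ⊖ (X^ 0)))))))

R : ℕ → ℕ → Poly
R a b = X^ (2 ℕ.* a ℕ.+ b) ⊕ (X^ (a ℕ.+ 2 ℕ.* b) ⊕ (X^ a ⊕ (X^ b
      ⊕ (X^ (2 ℕ.* a ℕ.+ 2 ℕ.* b) ⊕ (X^ (2 ℕ.* a) ⊕ (X^ (2 ℕ.* b) ⊕ X^ 0))))))

module Submission where

-- If (1 + x + ⋯ + x^(p-1)) h = f, the coefficients of f whose exponents lie in a
-- fixed residue class mod p add up to h(1), because every coefficient of h is
-- spread over p consecutive exponents.  Hence p ∣ f(1); as R a b (1) = 8 this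
-- rules out Φ p ∣ R a b.  As Q a b (1) = 0, every residue class contains as many
-- exponents of positive monomials (2a+b, a+2b, a, b) as of negative ones
-- (2a+2b, 2a, 2b, 0).  Comparing the class of 0 and, when p divides 2a+b or
-- a+2b, the class of −(a+b) forces p ∣ a and p ∣ b, since p ∤ 2, 3, 4, 5.

open import Defs
open import Data.Nat using (ℕ; _≤_; NonZero)
open import Data.Nat.Divisibility using (_∣_)
open import Data.Nat.Primality using (Prime)
open import Data.Sum using (_⊎_; inj₁; inj₂)
open import Data.Product using (_×_; _,_)

open import Data.Bool using (if_then_else_)
open import Data.Integer as ℤ using (ℤ; +_; 0ℤ; 1ℤ)
import Data.Integer.Properties as ℤₚ
open import Data.Integer.Divisibility.Signed using (divides; ∣⇒∣ᵤ)
open import Data.Integer.Tactic.RingSolver using (solve-∀)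
open import Data.List using (List; []; _∷_)
open import Data.Nat as ℕ using (zero; suc; _<_; _≤?_)
import Data.Nat.Properties as ℕₚ
open import Data.Nat.Divisibility
  using (_∣?_; _∣0; ∣-refl; ∣m+n∣m⇒∣n; ∣m∣n⇒∣m+n; ∣n⇒∣m*n; ∣⇒≤)
open import Data.Nat.Primality using (euclidsLemma; prime⇒nonZero)
import Data.Nat.Tactic.RingSolver as ℕ-Solver
open import Data.Sign as Sign using (Sign)
open import Function using (_∘_)
open import Relation.Binary.PropositionalEquality
  using (_≡_; _≢_; refl; sym; trans; cong; cong₂; subst; module ≡-Reasoning)
open import Relation.Nullary using (¬_; yes; no; contradiction)
open import Relation.Nullary.Decidable using (does; dec-true; dec-false; from-yes)

private variable
  a b d n x y : ℕ

⟨_,_⟩ : (ℕ → ℤ) → Poly → ℤ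
⟨ w , []     ⟩ = 0ℤ
⟨ w , c ∷ cs ⟩ = w 0 ℤ.* c ℤ.+ ⟨ w ∘ suc , cs ⟩

Σcoeff : Poly → ℤ
Σcoeff f = ⟨ (λ _ → 1ℤ) , f ⟩

⟨⟩-cong : ∀ {v w} → (∀ i → v i ≡ w i) → ∀ f → ⟨ v , f ⟩ ≡ ⟨ w , f ⟩
⟨⟩-cong v≗w []       = refl
⟨⟩-cong v≗w (c ∷ cs) = cong₂ (λ x y → x ℤ.* c ℤ.+ y) (v≗w 0) (⟨⟩-cong (v≗w ∘ suc) cs)

⟨⟩-+ʷ : ∀ u v f → ⟨ (λ i → u i ℤ.+ v i) , f ⟩ ≡ ⟨ u , f ⟩ ℤ.+ ⟨ v , f ⟩
⟨⟩-+ʷ u v []       = refl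
⟨⟩-+ʷ u v (c ∷ cs) rewrite ⟨⟩-+ʷ (u ∘ suc) (v ∘ suc) cs =
  distrib (u 0) (v 0) c ⟨ u ∘ suc , cs ⟩ ⟨ v ∘ suc , cs ⟩
  where
  distrib : ∀ x y c z t → (x ℤ.+ y) ℤ.* c ℤ.+ (z ℤ.+ t) ≡ (x ℤ.* c ℤ.+ z) ℤ.+ (y ℤ.* c ℤ.+ t)
  distrib = solve-∀

⟨⟩-const : ∀ c f → ⟨ (λ _ → c) , f ⟩ ≡ c ℤ.* Σcoeff f
⟨⟩-const c []       = sym (ℤₚ.*-zeroʳ c)
⟨⟩-const c (d ∷ ds) rewrite ⟨⟩-const c ds = distrib c d (Σcoeff ds)
  where
  distrib : ∀ c d z → c ℤ.* d ℤ.+ c ℤ.* z ≡ c ℤ.* (1ℤ ℤ.* d ℤ.+ z)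
  distrib = solve-∀

⟨⟩-zero : ∀ w f → (∀ n → coeff f n ≡ 0ℤ) → ⟨ w , f ⟩ ≡ 0ℤ
⟨⟩-zero w []       f≗0 = refl
⟨⟩-zero w (c ∷ cs) f≗0 rewrite f≗0 0 | ⟨⟩-zero (w ∘ suc) cs (f≗0 ∘ suc) =
  trans (ℤₚ.+-identityʳ _) (ℤₚ.*-zeroʳ (w 0))

⟨⟩-resp-≈P : ∀ w f g → f ≈P g → ⟨ w , f ⟩ ≡ ⟨ w , g ⟩
⟨⟩-resp-≈P w []       []       f≈g = refl
⟨⟩-resp-≈P w []       (d ∷ ds) f≈g = sym (⟨⟩-zero w (d ∷ ds) (sym ∘ f≈g))
⟨⟩-resp-≈P w (c ∷ cs) []       f≈g = ⟨⟩-zero w (c ∷ cs) f≈g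
⟨⟩-resp-≈P w (c ∷ cs) (d ∷ ds) f≈g =
  cong₂ (λ x y → w 0 ℤ.* x ℤ.+ y) (f≈g 0) (⟨⟩-resp-≈P (w ∘ suc) cs ds (f≈g ∘ suc))

⟨⟩-⊕ : ∀ w f g → ⟨ w , f ⊕ g ⟩ ≡ ⟨ w , f ⟩ ℤ.+ ⟨ w , g ⟩
⟨⟩-⊕ w []       g        = sym (ℤₚ.+-identityˡ _)
⟨⟩-⊕ w (c ∷ cs) []       = sym (ℤₚ.+-identityʳ _)
⟨⟩-⊕ w (c ∷ cs) (d ∷ ds) rewrite ⟨⟩-⊕ (w ∘ suc) cs ds =
  distrib (w 0) c d ⟨ w ∘ suc , cs ⟩ ⟨ w ∘ suc , ds ⟩
  where
  distrib : ∀ x c d z t → x ℤ.* (c ℤ.+ d) ℤ.+ (z ℤ.+ t) ≡ (x ℤ.* c ℤ.+ z) ℤ.+ (x ℤ.* d ℤ.+ t)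
  distrib = solve-∀

⟨⟩-· : ∀ w c f → ⟨ w , c · f ⟩ ≡ c ℤ.* ⟨ w , f ⟩
⟨⟩-· w c []       = sym (ℤₚ.*-zeroʳ c)
⟨⟩-· w c (d ∷ ds) rewrite ⟨⟩-· (w ∘ suc) c ds = distrib (w 0) c d ⟨ w ∘ suc , ds ⟩
  where
  distrib : ∀ x c d z → x ℤ.* (c ℤ.* d) ℤ.+ c ℤ.* z ≡ c ℤ.* (x ℤ.* d ℤ.+ z)
  distrib = solve-∀

⟨⟩-⊖ : ∀ w f → ⟨ w , ⊖ f ⟩ ≡ ℤ.- ⟨ w , f ⟩
⟨⟩-⊖ w []       = refl
⟨⟩-⊖ w (c ∷ cs) rewrite ⟨⟩-⊖ (w ∘ suc) cs = distrib (w 0) c ⟨ w ∘ suc , cs ⟩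
  where
  distrib : ∀ x c z → x ℤ.* ℤ.- c ℤ.+ ℤ.- z ≡ ℤ.- (x ℤ.* c ℤ.+ z)
  distrib = solve-∀

⟨⟩-X^ : ∀ w n → ⟨ w , X^ n ⟩ ≡ w n
⟨⟩-X^ w zero    = trans (ℤₚ.+-identityʳ _) (ℤₚ.*-identityʳ (w 0))
⟨⟩-X^ w (suc n) rewrite ⟨⟩-X^ (w ∘ suc) n | ℤₚ.*-zeroʳ (w 0) = ℤₚ.+-identityˡ _

slide : ℕ → (ℕ → ℤ) → ℕ → ℤ
slide zero    w i = 0ℤ
slide (suc k) w i = w i ℤ.+ slide k (w ∘ suc) i

slide-cong : ∀ {v w} k → (∀ i → v i ≡ w i) → ∀ i → slide k v i ≡ slide k w i
slide-cong zero    v≗w i = refl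
slide-cong (suc k) v≗w i = cong₂ ℤ._+_ (v≗w i) (slide-cong k (v≗w ∘ suc) i)

slide-1 : ∀ k i → slide k (λ _ → 1ℤ) i ≡ + k
slide-1 zero    i = refl
slide-1 (suc k) i = cong (ℤ._+_ 1ℤ) (slide-1 k i)

⟨⟩-Φ⊗ : ∀ k w h → ⟨ w , Φ k ⊗ h ⟩ ≡ ⟨ slide k w , h ⟩
⟨⟩-Φ⊗ zero    w h = sym (trans (⟨⟩-const 0ℤ h) (ℤₚ.*-zeroˡ (Σcoeff h)))
⟨⟩-Φ⊗ (suc k) w h = begin
  ⟨ w , 1ℤ · h ⊕ (0ℤ ∷ Φ k ⊗ h) ⟩
    ≡⟨ ⟨⟩-⊕ w (1ℤ · h) (0ℤ ∷ Φ k ⊗ h) ⟩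
  ⟨ w , 1ℤ · h ⟩ ℤ.+ (w 0 ℤ.* 0ℤ ℤ.+ ⟨ w ∘ suc , Φ k ⊗ h ⟩)
    ≡⟨ cong₂ ℤ._+_ (trans (⟨⟩-· w 1ℤ h) (ℤₚ.*-identityˡ _))
                   (trans (cong (ℤ._+ ⟨ w ∘ suc , Φ k ⊗ h ⟩) (ℤₚ.*-zeroʳ (w 0)))
                          (ℤₚ.+-identityˡ _)) ⟩
  ⟨ w , h ⟩ ℤ.+ ⟨ w ∘ suc , Φ k ⊗ h ⟩
    ≡⟨ cong (ℤ._+_ ⟨ w , h ⟩) (⟨⟩-Φ⊗ k (w ∘ suc) h) ⟩
  ⟨ w , h ⟩ ℤ.+ ⟨ slide k (w ∘ suc) , h ⟩
    ≡⟨ sym (⟨⟩-+ʷ w (slide k (w ∘ suc)) h) ⟩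
  ⟨ slide (suc k) w , h ⟩ ∎
  where open ≡-Reasoning

monomial : Sign × ℕ → Poly
monomial (Sign.+ , n) = X^ n
monomial (Sign.- , n) = ⊖ X^ n

weight : (ℕ → ℤ) → Sign × ℕ → ℤ
weight w (Sign.+ , n) = w n
weight w (Sign.- , n) = ℤ.- w n

-- ±xⁿ⁰ ⊕ (±xⁿ¹ ⊕ (⋯ ⊕ ±xⁿᵏ)), the shape in which Q and R are written
monomialSum : Sign × ℕ → List (Sign × ℕ) → Poly
monomialSum m []        = monomial m
monomialSum m (m′ ∷ ms) = monomial m ⊕ monomialSum m′ ms

weightSum : (ℕ → ℤ) → Sign × ℕ → List (Sign × ℕ) → ℤ
weightSum w m []        = weight w m
weightSum w m (m′ ∷ ms) = weight w m ℤ.+ weightSum w m′ ms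

⟨⟩-monomial : ∀ w m → ⟨ w , monomial m ⟩ ≡ weight w m
⟨⟩-monomial w (Sign.+ , n) = ⟨⟩-X^ w n
⟨⟩-monomial w (Sign.- , n) = trans (⟨⟩-⊖ w (X^ n)) (cong ℤ.-_ (⟨⟩-X^ w n))

⟨⟩-monomialSum : ∀ w m ms → ⟨ w , monomialSum m ms ⟩ ≡ weightSum w m ms
⟨⟩-monomialSum w m []        = ⟨⟩-monomial w m
⟨⟩-monomialSum w m (m′ ∷ ms) =
  trans (⟨⟩-⊕ w (monomial m) (monomialSum m′ ms))
        (cong₂ ℤ._+_ (⟨⟩-monomial w m) (⟨⟩-monomialSum w m′ ms))

⟨⟩-Q : ∀ w a b → ⟨ w , Q a b ⟩ ≡
  w (2 ℕ.* a ℕ.+ b) ℤ.+ (w (a ℕ.+ 2 ℕ.* b) ℤ.+ (w a ℤ.+ (w b ℤ.+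
  (ℤ.- w (2 ℕ.* a ℕ.+ 2 ℕ.* b) ℤ.+ (ℤ.- w (2 ℕ.* a) ℤ.+ (ℤ.- w (2 ℕ.* b) ℤ.+ ℤ.- w 0))))))
⟨⟩-Q w a b = ⟨⟩-monomialSum w (Sign.+ , 2 ℕ.* a ℕ.+ b)
  ((Sign.+ , a ℕ.+ 2 ℕ.* b) ∷ (Sign.+ , a) ∷ (Sign.+ , b) ∷ (Sign.- , 2 ℕ.* a ℕ.+ 2 ℕ.* b)
   ∷ (Sign.- , 2 ℕ.* a) ∷ (Sign.- , 2 ℕ.* b) ∷ (Sign.- , 0) ∷ [])

Σcoeff-Q : ∀ a b → Σcoeff (Q a b) ≡ 0ℤ
Σcoeff-Q a b = ⟨⟩-Q (λ _ → 1ℤ) a b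

Σcoeff-R : ∀ a b → Σcoeff (R a b) ≡ + 8
Σcoeff-R a b = ⟨⟩-monomialSum (λ _ → 1ℤ) (Sign.+ , 2 ℕ.* a ℕ.+ b)
  ((Sign.+ , a ℕ.+ 2 ℕ.* b) ∷ (Sign.+ , a) ∷ (Sign.+ , b) ∷ (Sign.+ , 2 ℕ.* a ℕ.+ 2 ℕ.* b)
   ∷ (Sign.+ , 2 ℕ.* a) ∷ (Sign.+ , 2 ℕ.* b) ∷ (Sign.+ , 0) ∷ [])

opaque
  [_∣_] : ℕ → ℕ → ℕ
  [ d ∣ n ] = if does (d ∣? n) then 1 else 0

  [∣]-yes : d ∣ n → [ d ∣ n ] ≡ 1
  [∣]-yes {d} {n} d∣n rewrite dec-true (d ∣? n) d∣n = refl

  [∣]-no : ¬ d ∣ n → [ d ∣ n ] ≡ 0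
  [∣]-no {d} {n} d∤n rewrite dec-false (d ∣? n) d∤n = refl

[∣]-periodic : ∀ d n → [ d ∣ n ℕ.+ d ] ≡ [ d ∣ n ]
[∣]-periodic d n with d ∣? n
... | yes d∣n = trans ([∣]-yes (∣m∣n⇒∣m+n d∣n ∣-refl)) (sym ([∣]-yes d∣n))
... | no  d∤n = trans ([∣]-no (d∤n ∘ cancel)) (sym ([∣]-no d∤n))
  where
  cancel : d ∣ n ℕ.+ d → d ∣ n
  cancel d∣n+d = ∣m+n∣m⇒∣n (subst (d ∣_) (ℕₚ.+-comm n d) d∣n+d) ∣-refl

#multiples : ℕ → ℕ → ℕ → ℕ
#multiples d zero    t = 0
#multiples d (suc k) t = [ d ∣ t ] ℕ.+ #multiples d k (suc t)

#multiples-snoc : ∀ d k t → #multiples d (suc k) t ≡ #multiples d k t ℕ.+ [ d ∣ t ℕ.+ k ]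
#multiples-snoc d zero    t rewrite ℕₚ.+-identityʳ t = ℕₚ.+-comm [ d ∣ t ] 0
#multiples-snoc d (suc k) t rewrite #multiples-snoc d k (suc t) | ℕₚ.+-suc t k =
  sym (ℕₚ.+-assoc [ d ∣ t ] (#multiples d k (suc t)) [ d ∣ suc (t ℕ.+ k) ])

#multiples-shift : ∀ d .{{_ : NonZero d}} t → #multiples d d (suc t) ≡ #multiples d d t
#multiples-shift d@(suc e) t = begin
  #multiples d d (suc t)       ≡⟨ #multiples-snoc d e (suc t) ⟩
  inner ℕ.+ [ d ∣ suc t ℕ.+ e ] ≡⟨ cong (λ n → inner ℕ.+ [ d ∣ n ]) (sym (ℕₚ.+-suc t e)) ⟩
  inner ℕ.+ [ d ∣ t ℕ.+ d ]     ≡⟨ cong (ℕ._+_ inner) ([∣]-periodic d t) ⟩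
  inner ℕ.+ [ d ∣ t ]           ≡⟨ ℕₚ.+-comm inner [ d ∣ t ] ⟩
  #multiples d d t             ∎
  where
  open ≡-Reasoning
  inner : ℕ
  inner = #multiples d e (suc t)

#multiples-below : ∀ d k t → suc t ℕ.+ k ≤ d → #multiples d k (suc t) ≡ 0
#multiples-below d zero    t _ = refl
#multiples-below d (suc k) t 2+t+k≤d =
  cong₂ ℕ._+_ ([∣]-no d∤1+t)
              (#multiples-below d k (suc t) (subst (ℕ._≤ d) (ℕₚ.+-suc (suc t) k) 2+t+k≤d))
  where
  d∤1+t : ¬ d ∣ suc t
  d∤1+t d∣1+t = ℕₚ.<⇒≱ (ℕₚ.<-≤-trans (ℕₚ.m<m+n (suc t) ℕₚ.0<1+n) 2+t+k≤d) (∣⇒≤ d∣1+t)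

#multiples-window : ∀ d .{{_ : NonZero d}} t → #multiples d d t ≡ 1
#multiples-window (suc e) zero
  rewrite [∣]-yes (suc e ∣0) | #multiples-below (suc e) e 0 ℕₚ.≤-refl = refl
#multiples-window d (suc t) = trans (#multiples-shift d t) (#multiples-window d t)

slide-[∣] : ∀ d k s i → slide k (λ j → + [ d ∣ s ℕ.+ j ]) i ≡ + #multiples d k (s ℕ.+ i)
slide-[∣] d zero    s i = refl
slide-[∣] d (suc k) s i = cong (ℤ._+_ (+ [ d ∣ s ℕ.+ i ])) (begin
  slide k (λ j → + [ d ∣ s ℕ.+ suc j ]) i
    ≡⟨ slide-cong k (λ j → cong (λ n → + [ d ∣ n ]) (ℕₚ.+-suc s j)) i ⟩
  slide k (λ j → + [ d ∣ suc s ℕ.+ j ]) i ≡⟨ slide-[∣] d k (suc s) i ⟩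
  + #multiples d k (suc s ℕ.+ i)           ∎)
  where open ≡-Reasoning

classSum : ℕ → ℕ → Poly → ℤ
classSum d s f = ⟨ (λ i → + [ d ∣ s ℕ.+ i ]) , f ⟩

Φ∣⇒p*classSum≡Σcoeff : ∀ p .{{_ : NonZero p}} f s → Φ p ∣P f → + p ℤ.* classSum p s f ≡ Σcoeff f
Φ∣⇒p*classSum≡Σcoeff p f s (h , Φh≈f) = begin
  + p ℤ.* ⟨ χ , f ⟩             ≡⟨ cong (ℤ._*_ (+ p)) (⟨⟩-resp-≈P χ f (Φ p ⊗ h) (sym ∘ Φh≈f)) ⟩
  + p ℤ.* ⟨ χ , Φ p ⊗ h ⟩       ≡⟨ cong (ℤ._*_ (+ p)) (⟨⟩-Φ⊗ p χ h) ⟩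
  + p ℤ.* ⟨ slide p χ , h ⟩     ≡⟨ cong (ℤ._*_ (+ p)) (⟨⟩-cong slide-χ≡1 h) ⟩
  + p ℤ.* Σcoeff h              ≡⟨ sym (⟨⟩-const (+ p) h) ⟩
  ⟨ (λ _ → + p) , h ⟩           ≡⟨ ⟨⟩-cong (λ i → sym (slide-1 p i)) h ⟩
  ⟨ slide p (λ _ → 1ℤ) , h ⟩    ≡⟨ sym (⟨⟩-Φ⊗ p (λ _ → 1ℤ) h) ⟩
  ⟨ (λ _ → 1ℤ) , Φ p ⊗ h ⟩      ≡⟨ ⟨⟩-resp-≈P (λ _ → 1ℤ) (Φ p ⊗ h) f Φh≈f ⟩
  Σcoeff f                      ∎
  where
  open ≡-Reasoning
  χ : ℕ → ℤ
  χ i = + [ p ∣ s ℕ.+ i ]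
  slide-χ≡1 : ∀ i → slide p χ i ≡ 1ℤ
  slide-χ≡1 i = trans (slide-[∣] p p s i) (cong +_ (#multiples-window p (s ℕ.+ i)))

module _ (p : ℕ) where

  -- how many exponents of positive, resp. negative, monomials of Q a b are ≡ −s (mod p)
  #⁺ #⁻ : ℕ → ℕ → ℕ → ℕ
  #⁺ a b s = ([ p ∣ s ℕ.+ a ] ℕ.+ [ p ∣ s ℕ.+ b ])
             ℕ.+ ([ p ∣ s ℕ.+ (2 ℕ.* a ℕ.+ b) ] ℕ.+ [ p ∣ s ℕ.+ (a ℕ.+ 2 ℕ.* b) ])
  #⁻ a b s = [ p ∣ s ℕ.+ 0 ]
             ℕ.+ ([ p ∣ s ℕ.+ (2 ℕ.* a ℕ.+ 2 ℕ.* b) ]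
                  ℕ.+ ([ p ∣ s ℕ.+ 2 ℕ.* a ] ℕ.+ [ p ∣ s ℕ.+ 2 ℕ.* b ]))

  Balanced : ℕ → ℕ → Set
  Balanced a b = ∀ s → #⁺ a b s ≡ #⁻ a b s

  #⁻-0≢0 : ∀ a b → #⁻ a b 0 ≢ 0
  #⁻-0≢0 a b rewrite [∣]-yes (p ∣0) = λ ()

  #⁺-swap : ∀ a b s → #⁺ b a s ≡ #⁺ a b s
  #⁺-swap a b s = cong₂ ℕ._+_ (ℕₚ.+-comm [ p ∣ s ℕ.+ b ] [ p ∣ s ℕ.+ a ])
    (trans (cong₂ ℕ._+_ (at (ℕₚ.+-comm (2 ℕ.* b) a)) (at (ℕₚ.+-comm b (2 ℕ.* a))))
           (ℕₚ.+-comm [ p ∣ s ℕ.+ (a ℕ.+ 2 ℕ.* b) ] [ p ∣ s ℕ.+ (2 ℕ.* a ℕ.+ b) ]))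
    where
    at : ∀ {m n} → m ≡ n → [ p ∣ s ℕ.+ m ] ≡ [ p ∣ s ℕ.+ n ]
    at = cong (λ m → [ p ∣ s ℕ.+ m ])

  #⁻-swap : ∀ a b s → #⁻ b a s ≡ #⁻ a b s
  #⁻-swap a b s = cong (ℕ._+_ [ p ∣ s ℕ.+ 0 ])
    (cong₂ ℕ._+_ (cong (λ m → [ p ∣ s ℕ.+ m ]) (ℕₚ.+-comm (2 ℕ.* b) (2 ℕ.* a)))
                 (ℕₚ.+-comm [ p ∣ s ℕ.+ 2 ℕ.* b ] [ p ∣ s ℕ.+ 2 ℕ.* a ]))

  Balanced-sym : ∀ {a b} → Balanced a b → Balanced b a
  Balanced-sym {a} {b} bal s = trans (#⁺-swap a b s) (trans (bal s) (sym (#⁻-swap a b s)))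

classSum-Q : ∀ p a b s → classSum p s (Q a b) ≡ + #⁺ p a b s ℤ.- + #⁻ p a b s
classSum-Q p a b s = trans (⟨⟩-Q (λ i → + [ p ∣ s ℕ.+ i ]) a b)
  (regroup (χ a) (χ b) (χ (2 ℕ.* a ℕ.+ b)) (χ (a ℕ.+ 2 ℕ.* b))
           (χ 0) (χ (2 ℕ.* a ℕ.+ 2 ℕ.* b)) (χ (2 ℕ.* a)) (χ (2 ℕ.* b)))
  where
  χ : ℕ → ℤ
  χ i = + [ p ∣ s ℕ.+ i ]
  regroup : ∀ x₁ x₂ x₃ x₄ y₁ y₂ y₃ y₄ →
    x₃ ℤ.+ (x₄ ℤ.+ (x₁ ℤ.+ (x₂ ℤ.+ (ℤ.- y₂ ℤ.+ (ℤ.- y₃ ℤ.+ (ℤ.- y₄ ℤ.+ ℤ.- y₁))))))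
    ≡ ((x₁ ℤ.+ x₂) ℤ.+ (x₃ ℤ.+ x₄)) ℤ.- (y₁ ℤ.+ (y₂ ℤ.+ (y₃ ℤ.+ y₄)))
  regroup = solve-∀

Φ∣Q⇒Balanced : ∀ p .{{_ : NonZero p}} a b → Φ p ∣P Q a b → Balanced p a b
Φ∣Q⇒Balanced p a b Φ∣Q s =
  ℤₚ.+-injective (ℤₚ.i-j≡0⇒i≡j _ _ (trans (sym (classSum-Q p a b s)) classSum≡0))
  where
  classSum≡0 : classSum p s (Q a b) ≡ 0ℤ
  classSum≡0 = ℤₚ.*-cancelˡ-≡ (+ p) _ 0ℤ
    (trans (Φ∣⇒p*classSum≡Σcoeff p (Q a b) s Φ∣Q) (trans (Σcoeff-Q a b) (sym (ℤₚ.*-zeroʳ (+ p)))))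

Φ∣R⇒∣8 : ∀ p .{{_ : NonZero p}} a b → Φ p ∣P R a b → p ∣ 8
Φ∣R⇒∣8 p a b Φ∣R = ∣⇒∣ᵤ (divides (classSum p 0 (R a b))
  (sym (trans (ℤₚ.*-comm _ (+ p)) (trans (Φ∣⇒p*classSum≡Σcoeff p (R a b) 0 Φ∣R) (Σcoeff-R a b)))))

module _ {p : ℕ} (p-prime : Prime p) (5<p : 5 < p) where

  ∣-cancel-small : ∀ k .{{_ : NonZero k}} → k ≤ 5 → p ∣ x → p ∣ y → x ℕ.+ k ℕ.* n ≡ y → p ∣ n
  ∣-cancel-small {x} {y} {n} k k≤5 p∣x p∣y eq
    with euclidsLemma k n p-prime (∣m+n∣m⇒∣n (subst (p ∣_) (sym eq) p∣y) p∣x)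
  ... | inj₁ p∣k = contradiction (∣⇒≤ p∣k) (ℕₚ.<⇒≱ (ℕₚ.≤-<-trans k≤5 5<p))
  ... | inj₂ p∣n = p∣n

  Balanced-∣a⇒∣b : Balanced p a b → p ∣ a → p ∣ b
  Balanced-∣a⇒∣b {a} {b} bal p∣a with p ∣? b
  ... | yes p∣b = p∣b
  ... | no  p∤b = contradiction (trans (sym #⁺≡1) (trans (bal 0) #⁻≡2)) λ ()
    where
    open ℕ-Solver using (solve)
    p∣2a : p ∣ 2 ℕ.* a
    p∣2a = ∣n⇒∣m*n 2 p∣a
    p∤2a+b : ¬ p ∣ 2 ℕ.* a ℕ.+ b
    p∤2a+b p∣t = p∤b (∣-cancel-small 1 (from-yes (1 ≤? 5)) p∣2a p∣t (solve (a ∷ b ∷ [])))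
    p∤a+2b : ¬ p ∣ a ℕ.+ 2 ℕ.* b
    p∤a+2b p∣t = p∤b (∣-cancel-small 2 (from-yes (2 ≤? 5)) p∣a p∣t (solve (a ∷ b ∷ [])))
    p∤2a+2b : ¬ p ∣ 2 ℕ.* a ℕ.+ 2 ℕ.* b
    p∤2a+2b p∣t = p∤b (∣-cancel-small 2 (from-yes (2 ≤? 5)) p∣2a p∣t (solve (a ∷ b ∷ [])))
    p∤2b : ¬ p ∣ 2 ℕ.* b
    p∤2b p∣t = p∤b (∣-cancel-small 2 (from-yes (2 ≤? 5)) (p ∣0) p∣t refl)
    #⁺≡1 : #⁺ p a b 0 ≡ 1
    #⁺≡1 rewrite [∣]-yes p∣a | [∣]-no p∤b | [∣]-no p∤2a+b | [∣]-no p∤a+2b = refl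
    #⁻≡2 : #⁻ p a b 0 ≡ 2
    #⁻≡2 rewrite [∣]-yes (p ∣0) | [∣]-no p∤2a+2b | [∣]-yes p∣2a | [∣]-no p∤2b = refl

  -- Shifted by s = a + b and reduced with b ≡ −2a, the exponents of Q become 0 (from 2a+b)
  -- and a, −a, −3a, −4a, −5a (from the others).
  Balanced-∤a⇒∤2a+b : Balanced p a b → ¬ p ∣ a → ¬ p ∣ 2 ℕ.* a ℕ.+ b
  Balanced-∤a⇒∤2a+b {a} {b} bal p∤a p∣c =
    contradiction (trans (sym #⁺≡1) (trans (bal (a ℕ.+ b)) #⁻≡0)) λ ()
    where
    open ℕ-Solver using (solve)
    p∣2c : p ∣ 2 ℕ.* (2 ℕ.* a ℕ.+ b)
    p∣2c = ∣n⇒∣m*n 2 p∣c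
    p∣3c : p ∣ 3 ℕ.* (2 ℕ.* a ℕ.+ b)
    p∣3c = ∣n⇒∣m*n 3 p∣c
    p∣s+a : p ∣ a ℕ.+ b ℕ.+ a
    p∣s+a = subst (p ∣_) regroup p∣c
      where
      regroup : 2 ℕ.* a ℕ.+ b ≡ a ℕ.+ b ℕ.+ a
      regroup = solve (a ∷ b ∷ [])
    p∤s+b : ¬ p ∣ a ℕ.+ b ℕ.+ b
    p∤s+b p∣t = p∤a (∣-cancel-small 3 (from-yes (3 ≤? 5)) p∣t p∣2c (solve (a ∷ b ∷ [])))
    p∤s+2a+b : ¬ p ∣ a ℕ.+ b ℕ.+ (2 ℕ.* a ℕ.+ b)
    p∤s+2a+b p∣t = p∤a (∣-cancel-small 1 (from-yes (1 ≤? 5)) p∣t p∣2c (solve (a ∷ b ∷ [])))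
    p∤s+a+2b : ¬ p ∣ a ℕ.+ b ℕ.+ (a ℕ.+ 2 ℕ.* b)
    p∤s+a+2b p∣t = p∤a (∣-cancel-small 4 (from-yes (4 ≤? 5)) p∣t p∣3c (solve (a ∷ b ∷ [])))
    p∤s+0 : ¬ p ∣ a ℕ.+ b ℕ.+ 0
    p∤s+0 p∣t = p∤a (∣-cancel-small 1 (from-yes (1 ≤? 5)) p∣t p∣c (solve (a ∷ b ∷ [])))
    p∤s+2a+2b : ¬ p ∣ a ℕ.+ b ℕ.+ (2 ℕ.* a ℕ.+ 2 ℕ.* b)
    p∤s+2a+2b p∣t = p∤a (∣-cancel-small 3 (from-yes (3 ≤? 5)) p∣t p∣3c (solve (a ∷ b ∷ [])))
    p∤s+2a : ¬ p ∣ a ℕ.+ b ℕ.+ 2 ℕ.* a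
    p∤s+2a p∣t = p∤a (∣-cancel-small 1 (from-yes (1 ≤? 5)) p∣c p∣t (solve (a ∷ b ∷ [])))
    p∤s+2b : ¬ p ∣ a ℕ.+ b ℕ.+ 2 ℕ.* b
    p∤s+2b p∣t = p∤a (∣-cancel-small 5 (from-yes (5 ≤? 5)) p∣t p∣3c (solve (a ∷ b ∷ [])))
    #⁺≡1 : #⁺ p a b (a ℕ.+ b) ≡ 1
    #⁺≡1 rewrite [∣]-yes p∣s+a | [∣]-no p∤s+b | [∣]-no p∤s+2a+b | [∣]-no p∤s+a+2b = refl
    #⁻≡0 : #⁻ p a b (a ℕ.+ b) ≡ 0
    #⁻≡0 rewrite [∣]-no p∤s+0 | [∣]-no p∤s+2a+2b | [∣]-no p∤s+2a | [∣]-no p∤s+2b = refl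

  Balanced⇒∣×∣ : Balanced p a b → p ∣ a × p ∣ b
  Balanced⇒∣×∣ {a} {b} bal with p ∣? a | p ∣? b
  ... | yes p∣a | _       = p∣a , Balanced-∣a⇒∣b bal p∣a
  ... | no  _   | yes p∣b = Balanced-∣a⇒∣b (Balanced-sym p bal) p∣b , p∣b
  ... | no  p∤a | no  p∤b with p ∣? 2 ℕ.* a ℕ.+ b | p ∣? a ℕ.+ 2 ℕ.* b
  ...   | yes p∣2a+b | _ = contradiction p∣2a+b (Balanced-∤a⇒∤2a+b bal p∤a)
  ...   | _ | yes p∣a+2b =
    contradiction (subst (p ∣_) (ℕₚ.+-comm a (2 ℕ.* b)) p∣a+2b)
                  (Balanced-∤a⇒∤2a+b (Balanced-sym p bal) p∤b)
  ...   | no p∤2a+b | no p∤a+2b = contradiction (trans (sym (bal 0)) #⁺≡0) (#⁻-0≢0 p a b)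
    where
    #⁺≡0 : #⁺ p a b 0 ≡ 0
    #⁺≡0 rewrite [∣]-no p∤a | [∣]-no p∤b | [∣]-no p∤2a+b | [∣]-no p∤a+2b = refl

lemma6p10 : (a b p : ℕ) → .{{NonZero a}} → .{{NonZero b}} → Prime p → 11 ≤ p →
    (Φ p ∣P Q a b) ⊎ (Φ p ∣P R a b) → (p ∣ a) × (p ∣ b)
lemma6p10 a b p p-prime 11≤p (inj₁ Φ∣Q) =
  Balanced⇒∣×∣ p-prime (ℕₚ.≤-trans (from-yes (6 ≤? 11)) 11≤p)
    (Φ∣Q⇒Balanced p {{prime⇒nonZero p-prime}} a b Φ∣Q)
lemma6p10 a b p p-prime 11≤p (inj₂ Φ∣R) =
  contradiction (∣⇒≤ (Φ∣R⇒∣8 p {{prime⇒nonZero p-prime}} a b Φ∣R))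
                (ℕₚ.<⇒≱ (ℕₚ.≤-trans (from-yes (9 ≤? 11)) 11≤p))
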